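{- Assume $\mathcal{L}_S$ and $\mathcal{L}_T$ each define a predicate $\cdot\checkmark : \mathcal{P} \to \mathbb{B}$. An encoding $[\![\cdot]\!] : \mathcal{P}_S \to \mathcal{P}_T$ reflects divergence, respects success, and is operationally corresponding w.r.t. a preorder $\mathcal{R}_T \subseteq \mathcal{P}_T^2$ that is a success respecting and divergence reflecting bisimulation iff $\exists \mathcal{R} .\ \left( \forall S .\ \left( S, [\![S]\!] \right) \in \mathcal{R} \right) \wedge \mathcal{R}_T = \mathcal{R}|_{\mathcal{P}_T} \wedge \left( \forall S, T .\ \left( S, T \right) \in \mathcal{R} \rightarrow \left( [\![S]\!], T \right) \in \mathcal{R}_T \right) \wedge \mathcal{R}$ reflects divergence, respects success, and is a preorder and a bisimulation.
   Context: Source $\langle \mathcal{P}_S, \longmapsto_S\rangle$, target $\langle \mathcal{P}_T, \longmapsto_T\rangle$, encoding $[\![\cdot]\!]$; $\longmapsto^{*}$ is the reflexive transitive closure of $\longmapsto$; $\mathcal{R}\subseteq(\mathcal{P}_S\uplus\mathcal{P}_T)^2$, $\mathcal{R}|_{\mathcal{P}_T}$ its restriction to target terms. Divergent: able to do an infinite sequence of steps; a relation reflects divergence if $(P,Q)\in\mathcal{R}$ and $Q$ divergent imply $P$ divergent. Success: $P\Downarrow\checkmark$ iff $\exists P'.\ P\longmapsto^{*}P'\wedge P'\checkmark$; respecting success means related terms (resp. $S$ and $[\![S]\!]$) agree on $\Downarrow\checkmark$. Operational correspondence w.r.t. $\mathcal{R}_T$: $S\longmapsto_S^{*}S'$ implies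 $\exists T.\ [\![S]\!]\longmapsto_T^{*}T\wedge([\![S']\!],T)\in\mathcal{R}_T$, and $[\![S]\!]\longmapsto_T^{*}T$ implies $\exists S'.\ S\longmapsto_S^{*}S'\wedge([\![S']\!],T)\in\mathcal{R}_T$. Bisimulation: for $(P,Q)\in\mathcal{R}$, $P\longmapsto^{*}P'$ implies $\exists Q'.\ Q\longmapsto^{*}Q'\wedge(P',Q')\in\mathcal{R}$ and symmetrically for $Q\longmapsto^{*}Q'$. -}

module Defs where

open import Data.Nat using (ℕ; zero; suc)
open import Data.Bool using (Bool; true)
open import Data.Sum using (_⊎_; inj₁; inj₂; [_,_])
open import Data.Product using (_×_; ∃; ∃-syntax; Σ-syntax)
open import Relation.Binary.PropositionalEquality using (_≡_)
open import Relation.Binary.Construct.Closure.ReflexiveTransitive using (Star)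
open import Function.Bundles using (_⇔_)

record Lang : Set₁ where
  field
    Proc : Set
    _⟼_ : Proc → Proc → Set
    succ : Proc → Bool

open Lang public

Relation : Set → Set₁
Relation A = A → A → Set

module Notions (L : Lang) where
  private
    P = Proc L
    _⟶_ = _⟼_ L

  _⟼*_ : P → P → Set
  _⟼*_ = Star _⟶_

  Success : P → Set
  Success p = succ L p ≡ true

  _⇓✓ : P → Set
  p ⇓✓ = ∃[ p' ] (p ⟼* p' × Success p')

  Divergent : P → Set
  Divergent p = Σ[ f ∈ (ℕ → P) ] (f 0 ≡ p × (∀ n → f n ⟶ f (suc n)))

  ReflectsDivergence : Relation P → Set
  ReflectsDivergence R = ∀ p q → R p q → Divergent q → Divergent p

  RespectsSuccess : Relation P → Set
  RespectsSuccess R = ∀ p q → R p q → (p ⇓✓ ⇔ q ⇓✓)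

  IsPreorderRel : Relation P → Set
  IsPreorderRel R = (∀ p → R p p) × (∀ p q r → R p q → R q r → R p r)

  Bisimulation : Relation P → Set
  Bisimulation R = ∀ p q → R p q →
      (∀ p' → p ⟼* p' → ∃[ q' ] (q ⟼* q' × R p' q'))
    × (∀ q' → q ⟼* q' → ∃[ p' ] (p ⟼* p' × R p' q'))

data SumStep (LS LT : Lang) : Proc LS ⊎ Proc LT → Proc LS ⊎ Proc LT → Set where
  stepS : ∀ {a b} → _⟼_ LS a b → SumStep LS LT (inj₁ a) (inj₁ b)
  stepT : ∀ {a b} → _⟼_ LT a b → SumStep LS LT (inj₂ a) (inj₂ b)

SumLang : Lang → Lang → Lang
SumLang LS LT = record
  { Proc = Proc LS ⊎ Proc LT
  ; _⟼_ = SumStep LS LT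
  ; succ = [ succ LS , succ LT ]
  }

Restrict : (LS LT : Lang) → Relation (Proc LS ⊎ Proc LT) → Relation (Proc LT)
Restrict LS LT R a b = R (inj₂ a) (inj₂ b)

module Encoding (LS LT : Lang) (enc : Proc LS → Proc LT) where
  private
    module S = Notions LS
    module T = Notions LT

  EncReflectsDivergence : Set
  EncReflectsDivergence = ∀ s → T.Divergent (enc s) → S.Divergent s

  EncRespectsSuccess : Set
  EncRespectsSuccess = ∀ s → (s S.⇓✓ ⇔ enc s T.⇓✓)

  OperationalCorrespondence : Relation (Proc LT) → Set
  OperationalCorrespondence RT =
      (∀ s s' → s S.⟼* s' → ∃[ t ] (enc s T.⟼* t × RT (enc s') t))
    × (∀ s t → enc s T.⟼* t → ∃[ s' ] (s S.⟼* s' × RT (enc s') t))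

  GoodEncoding : Relation (Proc LT) → Set
  GoodEncoding RT =
      EncReflectsDivergence
    × EncRespectsSuccess
    × OperationalCorrespondence RT
    × T.IsPreorderRel RT
    × T.RespectsSuccess RT
    × T.ReflectsDivergence RT
    × T.Bisimulation RT

  WitnessRelation : Relation (Proc LT) → Set₁
  WitnessRelation RT =
    Σ[ R ∈ Relation (Proc LS ⊎ Proc LT) ]
      ( (∀ s → R (inj₁ s) (inj₂ (enc s)))
      × (∀ a b → (RT a b ⇔ Restrict LS LT R a b))
      × (∀ s t → R (inj₁ s) (inj₂ t) → RT (enc s) t)
      × Notions.ReflectsDivergence (SumLang LS LT) R
      × Notions.RespectsSuccess (SumLang LS LT) R
      × Notions.IsPreorderRel (SumLang LS LT) R
      × Notions.Bisimulation (SumLang LS LT) R )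

-- Put source and target terms into one language (the disjoint union). Given the
-- encoding properties, the witness relates S to S, S to every T with ([[S]], T) ∈ R_T, and
-- R_T on target terms; operational correspondence composed with the bisimulation R_T makes it a
-- bisimulation. Conversely, every property of R transfers to R_T (its restriction) and to the pairs
-- (S, [[S]]), because reductions, divergence and success of a term of either side inside the union
-- are exactly those it has in its own language.
module Submission where

open import Defs
open import Data.Nat using (zero; suc)
open import Data.Empty using (⊥)
open import Data.Sum using (_⊎_; inj₁; inj₂)
open import Data.Product using (_×_; _,_; proj₁; proj₂; map₂; ∃-syntax)
open import Function.Bundles using (_⇔_; mk⇔; Equivalence)
open import Function.Construct.Composition using (_⇔-∘_)
open import Function.Construct.Symmetry using (⇔-sym)
open import Function.Construct.Identity using (⇔-id)
open import Relation.Binary.PropositionalEquality using (_≡_; refl; sym; trans; cong; subst)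
open import Relation.Binary.Construct.Closure.ReflexiveTransitive using (ε; _◅_; gmap)

record Embedding (L M : Lang) : Set where
  field
    ι        : Proc L → Proc M
    ι-step   : ∀ {a b} → _⟼_ L a b → _⟼_ M (ι a) (ι b)
    ι-step⁻¹ : ∀ {a q} → _⟼_ M (ι a) q → ∃[ b ] (q ≡ ι b × _⟼_ L a b)
    ι-succ   : ∀ a → succ M (ι a) ≡ succ L a

module EmbeddingProperties {L M : Lang} (E : Embedding L M) where
  open Embedding E public
  private
    module L = Notions L
    module M = Notions M

  ι-steps : ∀ {a b} → a L.⟼* b → ι a M.⟼* ι b
  ι-steps = gmap ι ι-step

  ι-steps⁻¹ : ∀ {a q} → ι a M.⟼* q → ∃[ b ] (q ≡ ι b × a L.⟼* b)
  ι-steps⁻¹ {a} ε = a , refl , ε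
  ι-steps⁻¹ (s ◅ ss) with ι-step⁻¹ s
  ... | _ , refl , s′ with ι-steps⁻¹ ss
  ...   | c , refl , ss′ = c , refl , s′ ◅ ss′

  ι-⇓✓ : ∀ a → ι a M.⇓✓ ⇔ a L.⇓✓
  ι-⇓✓ a = mk⇔ to from
    where
    to : ι a M.⇓✓ → a L.⇓✓
    to (_ , ss , ok) with ι-steps⁻¹ ss
    ... | b , refl , ss′ = b , ss′ , trans (sym (ι-succ b)) ok

    from : a L.⇓✓ → ι a M.⇓✓
    from (b , ss , ok) = ι b , ι-steps ss , trans (ι-succ b) ok

  ι-divergent : ∀ {a} → L.Divergent a → M.Divergent (ι a)
  ι-divergent (f , f0 , f-step) = (λ n → ι (f n)) , cong ι f0 , (λ n → ι-step (f-step n))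

  -- The run of ι a is pulled back step by step: `trace n` finds the preimage of its n-th term.
  ι-divergent⁻¹ : ∀ {a} → M.Divergent (ι a) → L.Divergent a
  ι-divergent⁻¹ {a} (f , f0 , f-step) = (λ n → proj₁ (trace n)) , refl , (λ n → proj₂ (proj₂ (next n)))
    where
    trace : ∀ n → ∃[ b ] (f n ≡ ι b)
    next  : ∀ n → ∃[ c ] (f (suc n) ≡ ι c × _⟼_ L (proj₁ (trace n)) c)
    trace zero    = a , f0
    trace (suc n) = proj₁ (next n) , proj₁ (proj₂ (next n))
    next n = ι-step⁻¹ (subst (λ p → _⟼_ M p (f (suc n))) (proj₂ (trace n)) (f-step n))

inj₁-embedding : (LS LT : Lang) → Embedding LS (SumLang LS LT)
inj₁-embedding LS LT = record
  { ι = inj₁ ; ι-step = stepS ; ι-step⁻¹ = λ { (stepS s) → _ , refl , s } ; ι-succ = λ _ → refl }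

inj₂-embedding : (LS LT : Lang) → Embedding LT (SumLang LS LT)
inj₂-embedding LS LT = record
  { ι = inj₂ ; ι-step = stepT ; ι-step⁻¹ = λ { (stepT s) → _ , refl , s } ; ι-succ = λ _ → refl }

-- A relation R on M, seen between terms of L₁ and L₂ through two embeddings into M.
module Across {L₁ L₂ M : Lang} (E₁ : Embedding L₁ M) (E₂ : Embedding L₂ M)
              (R : Relation (Proc M)) where
  private
    module L₁ = Notions L₁
    module L₂ = Notions L₂
    module M = Notions M
    module E₁ = EmbeddingProperties E₁
    module E₂ = EmbeddingProperties E₂
    open E₁ using () renaming (ι to ι₁)
    open E₂ using () renaming (ι to ι₂)

  restricted-reflectsDivergence : M.ReflectsDivergence R →
    ∀ {a b} → R (ι₁ a) (ι₂ b) → L₂.Divergent b → L₁.Divergent a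
  restricted-reflectsDivergence R-div r d = E₁.ι-divergent⁻¹ (R-div _ _ r (E₂.ι-divergent d))

  restricted-respectsSuccess : M.RespectsSuccess R →
    ∀ {a b} → R (ι₁ a) (ι₂ b) → a L₁.⇓✓ ⇔ b L₂.⇓✓
  restricted-respectsSuccess R-succ {a} {b} r = E₂.ι-⇓✓ b ⇔-∘ (R-succ _ _ r ⇔-∘ ⇔-sym (E₁.ι-⇓✓ a))

  restricted-simulation : M.Bisimulation R → ∀ {a b} → R (ι₁ a) (ι₂ b) →
    ∀ {a′} → a L₁.⟼* a′ → ∃[ b′ ] (b L₂.⟼* b′ × R (ι₁ a′) (ι₂ b′))
  restricted-simulation R-bisim r ss with proj₁ (R-bisim _ _ r) _ (E₁.ι-steps ss)
  ... | _ , tt , r′ with E₂.ι-steps⁻¹ tt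
  ...   | b′ , refl , tt′ = b′ , tt′ , r′

  restricted-simulation⁻¹ : M.Bisimulation R → ∀ {a b} → R (ι₁ a) (ι₂ b) →
    ∀ {b′} → b L₂.⟼* b′ → ∃[ a′ ] (a L₁.⟼* a′ × R (ι₁ a′) (ι₂ b′))
  restricted-simulation⁻¹ R-bisim r tt with proj₂ (R-bisim _ _ r) _ (E₂.ι-steps tt)
  ... | _ , ss , r′ with E₁.ι-steps⁻¹ ss
  ...   | a′ , refl , ss′ = a′ , ss′ , r′

  extended-simulation : ∀ {a b} →
    (∀ {a′} → a L₁.⟼* a′ → ∃[ b′ ] (b L₂.⟼* b′ × R (ι₁ a′) (ι₂ b′))) →
    ∀ p′ → ι₁ a M.⟼* p′ → ∃[ q′ ] (ι₂ b M.⟼* q′ × R p′ q′)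
  extended-simulation sim _ ss with E₁.ι-steps⁻¹ ss
  ... | _ , refl , ss′ with sim ss′
  ...   | b′ , tt , r′ = ι₂ b′ , E₂.ι-steps tt , r′

  extended-simulation⁻¹ : ∀ {a b} →
    (∀ {b′} → b L₂.⟼* b′ → ∃[ a′ ] (a L₁.⟼* a′ × R (ι₁ a′) (ι₂ b′))) →
    ∀ q′ → ι₂ b M.⟼* q′ → ∃[ p′ ] (ι₁ a M.⟼* p′ × R p′ q′)
  extended-simulation⁻¹ sim _ tt with E₂.ι-steps⁻¹ tt
  ... | _ , refl , tt′ with sim tt′
  ...   | a′ , ss , r′ = ι₁ a′ , E₁.ι-steps ss , r′

module Lemma13 (LS LT : Lang) (enc : Proc LS → Proc LT) (RT : Relation (Proc LT)) where
  open Encoding LS LT enc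
  private
    module S = Notions LS
    module T = Notions LT
    module N = Notions (SumLang LS LT)
    module E₁ = EmbeddingProperties (inj₁-embedding LS LT)
    module E₂ = EmbeddingProperties (inj₂-embedding LS LT)

  Induced : Relation (Proc LS ⊎ Proc LT)
  Induced (inj₁ s) (inj₁ s′) = s ≡ s′
  Induced (inj₁ s) (inj₂ t)  = RT (enc s) t
  Induced (inj₂ t) (inj₁ s)  = ⊥
  Induced (inj₂ t) (inj₂ t′) = RT t t′

  private
    module S→T = Across (inj₁-embedding LS LT) (inj₂-embedding LS LT)
    module T→T = Across (inj₂-embedding LS LT) (inj₂-embedding LS LT)

  induced-isPreorder : T.IsPreorderRel RT → N.IsPreorderRel Induced
  induced-isPreorder (RT-refl , RT-trans) = reflexive , transitive
    where
    reflexive : ∀ p → Induced p p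
    reflexive (inj₁ s) = refl
    reflexive (inj₂ t) = RT-refl t

    transitive : ∀ p q r → Induced p q → Induced q r → Induced p r
    transitive (inj₁ _) (inj₁ _) (inj₁ _) refl x = x
    transitive (inj₁ _) (inj₁ _) (inj₂ _) refl x = x
    transitive (inj₁ _) (inj₂ _) (inj₂ _) x y = RT-trans _ _ _ x y
    transitive (inj₂ _) (inj₂ _) (inj₂ _) x y = RT-trans _ _ _ x y

  induced-reflectsDivergence : EncReflectsDivergence → T.ReflectsDivergence RT →
    N.ReflectsDivergence Induced
  induced-reflectsDivergence enc-div RT-div = λ where
    (inj₁ _) (inj₁ _) refl d → d
    (inj₁ s) (inj₂ t) r d →
      E₁.ι-divergent (enc-div s (RT-div _ _ r (E₂.ι-divergent⁻¹ d)))
    (inj₂ _) (inj₂ _) r d → E₂.ι-divergent (RT-div _ _ r (E₂.ι-divergent⁻¹ d))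

  induced-respectsSuccess : EncRespectsSuccess → T.RespectsSuccess RT →
    N.RespectsSuccess Induced
  induced-respectsSuccess enc-succ RT-succ = λ where
    (inj₁ s) (inj₁ _) refl → ⇔-id _
    (inj₁ s) (inj₂ t) r →
      ⇔-sym (E₂.ι-⇓✓ t) ⇔-∘ (RT-succ _ _ r ⇔-∘ (enc-succ s ⇔-∘ E₁.ι-⇓✓ s))
    (inj₂ t) (inj₂ t′) r → ⇔-sym (E₂.ι-⇓✓ t′) ⇔-∘ (RT-succ _ _ r ⇔-∘ E₂.ι-⇓✓ t)

  -- Operational correspondence and the bisimulation R_T are glued by transitivity of R_T.
  module _ (oc : OperationalCorrespondence RT) (RT-trans : ∀ a b c → RT a b → RT b c → RT a c)
           (RT-bisim : T.Bisimulation RT) where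

    encoded-simulation : ∀ {s t} → RT (enc s) t →
      ∀ {s′} → s S.⟼* s′ → ∃[ t′ ] (t T.⟼* t′ × RT (enc s′) t′)
    encoded-simulation r ss with proj₁ oc _ _ ss
    ... | u , uu , r₁ with proj₁ (RT-bisim _ _ r) u uu
    ...   | t′ , tt , r₂ = t′ , tt , RT-trans _ _ _ r₁ r₂

    encoded-simulation⁻¹ : ∀ {s t} → RT (enc s) t →
      ∀ {t′} → t T.⟼* t′ → ∃[ s′ ] (s S.⟼* s′ × RT (enc s′) t′)
    encoded-simulation⁻¹ r tt with proj₂ (RT-bisim _ _ r) _ tt
    ... | u , uu , r₁ with proj₂ oc _ u uu
    ...   | s′ , ss , r₂ = s′ , ss , RT-trans _ _ _ r₂ r₁

  induced-bisimulation : OperationalCorrespondence RT → T.IsPreorderRel RT →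
    T.Bisimulation RT → N.Bisimulation Induced
  induced-bisimulation _ RT-pre _ (inj₁ _) (inj₁ _) refl =
    (λ p′ ss → p′ , ss , reflexive p′) , (λ q′ ss → q′ , ss , reflexive q′)
    where reflexive = proj₁ (induced-isPreorder RT-pre)
  induced-bisimulation oc (_ , RT-trans) RT-bisim (inj₁ _) (inj₂ _) r =
      S→T.extended-simulation Induced (encoded-simulation oc RT-trans RT-bisim r)
    , S→T.extended-simulation⁻¹ Induced (encoded-simulation⁻¹ oc RT-trans RT-bisim r)
  induced-bisimulation _ _ RT-bisim (inj₂ a) (inj₂ b) r =
      T→T.extended-simulation Induced (proj₁ (RT-bisim a b r) _)
    , T→T.extended-simulation⁻¹ Induced (proj₂ (RT-bisim a b r) _)

  good⇒witness : GoodEncoding RT → WitnessRelation RT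
  good⇒witness (enc-div , enc-succ , oc , RT-pre , RT-succ , RT-div , RT-bisim) =
      Induced , (λ s → proj₁ RT-pre (enc s)) , (λ _ _ → ⇔-id _) , (λ _ _ r → r)
    , induced-reflectsDivergence enc-div RT-div
    , induced-respectsSuccess enc-succ RT-succ
    , induced-isPreorder RT-pre
    , induced-bisimulation oc RT-pre RT-bisim

  witness⇒good : WitnessRelation RT → GoodEncoding RT
  witness⇒good (R , R-enc , RT⇔R , R⇒RT , R-div , R-succ , (R-refl , R-trans) , R-bisim) =
      (λ s → S→T.restricted-reflectsDivergence R R-div (R-enc s))
    , (λ s → S→T.restricted-respectsSuccess R R-succ (R-enc s))
    , ( (λ s s′ ss → map₂ (map₂ (R⇒RT s′ _)) (S→T.restricted-simulation R R-bisim (R-enc s) ss))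
      , (λ s t tt → map₂ (map₂ (R⇒RT _ t)) (S→T.restricted-simulation⁻¹ R R-bisim (R-enc s) tt)))
    , ((λ t → from (R-refl (inj₂ t))) , (λ _ _ _ x y → from (R-trans _ _ _ (to x) (to y))))
    , (λ _ _ r → T→T.restricted-respectsSuccess R R-succ (to r))
    , (λ _ _ r → T→T.restricted-reflectsDivergence R R-div (to r))
    , (λ _ _ r → (λ _ ss → map₂ (map₂ from) (T→T.restricted-simulation R R-bisim (to r) ss))
                , (λ _ tt → map₂ (map₂ from) (T→T.restricted-simulation⁻¹ R R-bisim (to r) tt)))
    where
    to : ∀ {a b} → RT a b → R (inj₂ a) (inj₂ b)
    to = Equivalence.to (RT⇔R _ _)

    from : ∀ {a b} → R (inj₂ a) (inj₂ b) → RT a b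
    from = Equivalence.from (RT⇔R _ _)

lemma13 : (LS LT : Lang) (enc : Proc LS → Proc LT) (RT : Relation (Proc LT))
    → Encoding.GoodEncoding LS LT enc RT ⇔ Encoding.WitnessRelation LS LT enc RT
lemma13 LS LT enc RT = mk⇔ good⇒witness witness⇒good
  where open Lemma13 LS LT enc RT
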